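{- Let $a, b$ be integers with $2 \le a < b$ and $a \mid b$. Then there exists $C > 0$, depending only on $a$ and $b$, such that for all sufficiently large integers $n$ (the threshold depending only on $a$, $b$ and $C$) and every positive integer $N$ divisible by $a^n$ but not by $b$, one has \[ c_b(N) > C \log n. \] Moreover, any constant $C$ with $0 < C < \left(\log\left(\frac{\log b}{\log a}\right)\right)^{ -1}$ is admissible.
   Context: For an integer $b \ge 2$ and a nonnegative integer $N$, $c_b(N)$ denotes the number of nonzero digits in the base-$b$ expansion of $N$. $\log$ denotes the natural logarithm.
   Formalization: The constant C is taken among the positive rationals, both where its existence is asserted and where every C in the stated admissible range is claimed to work. -}

module Defs where

open import Data.Nat using (ℕ; zero; suc; _+_; _*_; _^_; _<_; NonZero; _!)
open import Data.Nat.DivMod using (_/_; _%_)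
open import Data.Product using (∃)

-- Number of nonzero base-(2+k) digits of N, computed with fuel.
-- Fuel ≥ N suffices, since each step divides by the base ≥ 2.
nzDigitsFuel : (b : ℕ) → .{{NonZero b}} → ℕ → ℕ → ℕ
nzDigitsFuel b zero    N = 0
nzDigitsFuel b (suc f) zero = 0
nzDigitsFuel b (suc f) N@(suc _) with N % b
... | zero  = nzDigitsFuel b f (N / b)
... | suc _ = suc (nzDigitsFuel b f (N / b))

-- c_b(N): number of nonzero digits of N in base b (meaningful for b ≥ 2).
-- (The base-0 case is junk; the theorem only uses b ≥ 2.)
c : ℕ → ℕ → ℕ
c zero    N = 0
c (suc b) N = nzDigitsFuel (suc b) N N

-- expScaled m K = K! * Σ_{j=0}^{K} m^j / j!   (an exact natural number)
expScaled : ℕ → ℕ → ℕ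
expScaled m zero    = 1
expScaled m (suc K) = suc K * expScaled m K + m ^ suc K

-- ExpGt m x y  ⇔  e^m > x / y   (for y > 0).
-- Partial sums Σ_{j≤K} m^j/j! increase strictly to e^m, so e^m > x/y iff
-- some partial sum exceeds x/y, i.e. x * K! < y * expScaled m K.
ExpGt : ℕ → ℕ → ℕ → Set
ExpGt m x y = ∃ λ K → x * (K !) < y * expScaled m K

{-# OPTIONS --safe #-}
module Submission where

-- Let N have its nonzero base-b digits at positions 0 = e₁ < e₂ < ⋯ < e_k, k = c_b(N). As a ∣ b,
-- a^min(n, e_{i+1}) divides the part of N below position e_{i+1}, a number in [1, b^(e_i + 1)); with
-- b^v < a^u this gives v · min(n, e_{i+1}) < u · (e_i + 1). So the positions grow at most like (u/v)^i
-- until they pass n, whence n ≤ u (u/v)^k. If a partial sum of the exponential series shows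
-- e^m > (u/v)^p, then e^{mk} > n^p for k large, i.e. c_b(N) > (p/m) log n; taking the k-th power of
-- the partial sum rests on S_A(x) S_B(y) ≤ S_{A+B}(x + y), a consequence of the binomial theorem.

open import Defs
open import Data.Nat.Base
open import Data.Nat.Properties
open import Algebra.Properties.CommutativeSemigroup *-commutativeSemigroup
  using (x∙yz≈y∙xz; x∙yz≈yx∙z; xy∙z≈xz∙y; xy∙z≈y∙xz)
import Algebra.Properties.CommutativeSemigroup +-commutativeSemigroup as +
import Algebra.Definitions.RawMonoid +-0-rawMonoid as Additive
open import Algebra.Properties.Monoid.Sum +-0-monoid using (sum; sum-cong-≗)
import Algebra.Properties.CommutativeSemiring.Binomial +-*-commutativeSemiring as Binomial
import Algebra.Properties.CommutativeSemiring.Exp +-*-commutativeSemiring as SemiringExp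
open import Data.Fin.Base using (Fin; toℕ)
open import Data.Fin.Properties using (toℕ≤pred[n])
open import Data.Nat.Combinatorics using (_C_; nCk≡n!/k![n-k]!; k![n∸k]!∣n!)
open import Data.Nat.DivMod using (_/_; _%_; m/n*n≡m; m≡m%n+[m/n]*n; m%n<n; m/n<m)
open import Data.Nat.Divisibility
  using (_∣_; ∣-refl; ∣-trans; *-pres-∣; *-monoʳ-∣; 1∣_; ∣m+n∣m⇒∣n; ∣m⇒∣m*n; ∣⇒≤; _∣0; m%n≡0⇒n∣m)
open import Data.Nat.Tactic.RingSolver using (solve-∀)
open import Data.Product.Base using (Σ; ∃; _×_; _,_)
open import Function.Base using (_$_)
open import Relation.Binary.PropositionalEquality
  using (_≡_; refl; sym; trans; cong; cong₂; subst; subst₂; module ≡-Reasoning)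
open import Relation.Nullary using (¬_; yes; no; contradiction)

^≡semiring-^ : ∀ x n → x ^ n ≡ x SemiringExp.^ n
^≡semiring-^ x zero    = refl
^≡semiring-^ x (suc n) = cong (x *_) (^≡semiring-^ x n)

*≡× : ∀ n x → n * x ≡ n Additive.× x
*≡× zero    x = refl
*≡× (suc n) x = cong (x +_) (*≡× n x)

^-distribʳ-* : ∀ m n o → (m * n) ^ o ≡ m ^ o * n ^ o
^-distribʳ-* m n o = begin
  (m * n) ^ o                          ≡⟨ ^≡semiring-^ (m * n) o ⟩
  (m * n) SemiringExp.^ o              ≡⟨ SemiringExp.^-distrib-* m n o ⟩
  m SemiringExp.^ o * n SemiringExp.^ o ≡⟨ cong₂ _*_ (^≡semiring-^ m o) (^≡semiring-^ n o) ⟨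
  m ^ o * n ^ o                        ∎
  where open ≡-Reasoning

^-^-comm : ∀ m n o → (m ^ n) ^ o ≡ (m ^ o) ^ n
^-^-comm m n o = trans (^-*-assoc m n o) (trans (cong (m ^_) (*-comm n o)) (sym (^-*-assoc m o n)))

^-cancelˡ-< : ∀ m .{{_ : NonZero m}} {n o} → m ^ n < m ^ o → n < o
^-cancelˡ-< m mⁿ<mᵒ = ≰⇒> λ o≤n → <⇒≱ mⁿ<mᵒ (^-monoʳ-≤ m o≤n)

^-monoˡ-∣ : ∀ {m n} o → m ∣ n → m ^ o ∣ n ^ o
^-monoˡ-∣ zero    m∣n = ∣-refl
^-monoˡ-∣ (suc o) m∣n = *-pres-∣ m∣n (^-monoˡ-∣ o m∣n)

^-monoʳ-∣ : ∀ m {n o} → n ≤ o → m ^ n ∣ m ^ o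
^-monoʳ-∣ m z≤n       = 1∣ _
^-monoʳ-∣ m (s≤s n≤o) = *-monoʳ-∣ m (^-monoʳ-∣ m n≤o)

bernoulli : ∀ α K → (α + K) * α ^ K ≤ α * suc α ^ K
bernoulli α zero    = ≤-reflexive (cong (_* 1) (+-identityʳ α))
bernoulli α (suc K) = begin
  (α + suc K) * (α * α ^ K)              ≤⟨ m≤m+n _ (K * α ^ K) ⟩
  (α + suc K) * (α * α ^ K) + K * α ^ K  ≡⟨ expand α K (α ^ K) ⟩
  suc α * ((α + K) * α ^ K)              ≤⟨ *-monoʳ-≤ (suc α) (bernoulli α K) ⟩
  suc α * (α * suc α ^ K)                ≡⟨ x∙yz≈y∙xz (suc α) α _ ⟩
  α * (suc α * suc α ^ K)                ∎
  where
  open ≤-Reasoning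
  expand : ∀ a k p → (a + suc k) * (a * p) + k * p ≡ suc a * ((a + k) * p)
  expand = solve-∀

-- Bernoulli: (n/m)^k ≥ (1 + 1/m)^k ≥ 1 + k/m > c.
c*m^k<n^k : ∀ {m n} c k .{{_ : NonZero m}} → m < n → c * m ≤ k → c * m ^ k < n ^ k
c*m^k<n^k {m} {n} c k m<n cm≤k = *-cancelˡ-< m _ _ $ begin-strict
  m * (c * m ^ k)    ≡⟨ x∙yz≈yx∙z m c (m ^ k) ⟩
  c * m * m ^ k      ≤⟨ *-monoˡ-≤ (m ^ k) cm≤k ⟩
  k * m ^ k          <⟨ *-monoˡ-< (m ^ k) {{m^n≢0 m k}} (m<n+m k (>-nonZero⁻¹ m)) ⟩
  (m + k) * m ^ k    ≤⟨ bernoulli m k ⟩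
  m * suc m ^ k      ≤⟨ *-monoʳ-≤ m (^-monoˡ-≤ k m<n) ⟩
  m * n ^ k          ∎
  where open ≤-Reasoning

-- Antidiagonal sums and the binomial theorem

-- antidiag N f = ∑_{i + j = N} f i j
antidiag : ℕ → (ℕ → ℕ → ℕ) → ℕ
antidiag zero    f = f 0 0
antidiag (suc N) f = f 0 (suc N) + antidiag N (λ i j → f (suc i) j)

antidiag-cong : ∀ N {f g} → (∀ i j → i + j ≡ N → f i j ≡ g i j) → antidiag N f ≡ antidiag N g
antidiag-cong zero    f≡g = f≡g 0 0 refl
antidiag-cong (suc N) f≡g =
  cong₂ _+_ (f≡g 0 (suc N) refl) (antidiag-cong N λ i j i+j≡N → f≡g (suc i) j (cong suc i+j≡N))

antidiag-mono-≤ : ∀ N {f g} → (∀ i j → i + j ≡ N → f i j ≤ g i j) → antidiag N f ≤ antidiag N g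
antidiag-mono-≤ zero    f≤g = f≤g 0 0 refl
antidiag-mono-≤ (suc N) f≤g =
  +-mono-≤ (f≤g 0 (suc N) refl) (antidiag-mono-≤ N λ i j i+j≡N → f≤g (suc i) j (cong suc i+j≡N))

antidiag-distrib-+ : ∀ N f g → antidiag N (λ i j → f i j + g i j) ≡ antidiag N f + antidiag N g
antidiag-distrib-+ zero    f g = refl
antidiag-distrib-+ (suc N) f g = begin
  f 0 (suc N) + g 0 (suc N) + antidiag N (λ i j → f′ i j + g′ i j)
    ≡⟨ cong (f 0 (suc N) + g 0 (suc N) +_) (antidiag-distrib-+ N f′ g′) ⟩
  f 0 (suc N) + g 0 (suc N) + (antidiag N f′ + antidiag N g′)
    ≡⟨ +-interchange (f 0 (suc N)) (g 0 (suc N)) (antidiag N f′) (antidiag N g′) ⟩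
  f 0 (suc N) + antidiag N f′ + (g 0 (suc N) + antidiag N g′) ∎
  where
  open ≡-Reasoning
  f′ g′ : ℕ → ℕ → ℕ
  f′ i = f (suc i)
  g′ i = g (suc i)
  +-interchange : ∀ a b c d → a + b + (c + d) ≡ a + c + (b + d)
  +-interchange = solve-∀

*-distribˡ-antidiag : ∀ N c f → c * antidiag N f ≡ antidiag N (λ i j → c * f i j)
*-distribˡ-antidiag zero    c f = refl
*-distribˡ-antidiag (suc N) c f =
  trans (*-distribˡ-+ c _ _) (cong (c * f 0 (suc N) +_) (*-distribˡ-antidiag N c _))

antidiag-last : ∀ N f → antidiag (suc N) f ≡ antidiag N (λ i j → f i (suc j)) + f (suc N) 0
antidiag-last zero    f = refl
antidiag-last (suc N) f =
  trans (cong (f 0 (suc (suc N)) +_) (antidiag-last N (λ i → f (suc i))))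
        (sym (+-assoc (f 0 (suc (suc N))) _ _))

antidiag-shift-≤ : ∀ B N f → antidiag N (λ i j → f i (B + j)) ≤ antidiag (B + N) f
antidiag-shift-≤ zero    N f = ≤-refl
antidiag-shift-≤ (suc B) N f = begin
  antidiag N (λ i j → f i (suc (B + j)))                      ≤⟨ antidiag-shift-≤ B N _ ⟩
  antidiag (B + N) (λ i j → f i (suc j))                      ≤⟨ m≤m+n _ _ ⟩
  antidiag (B + N) (λ i j → f i (suc j)) + f (suc (B + N)) 0  ≡⟨ antidiag-last (B + N) f ⟨
  antidiag (suc B + N) f                                      ∎
  where open ≤-Reasoning

antidiag≡sum : ∀ N f → antidiag N f ≡ sum {suc N} (λ k → f (toℕ k) (N ∸ toℕ k))
antidiag≡sum zero    f = sym (+-identityʳ (f 0 0))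
antidiag≡sum (suc N) f = cong (f 0 (suc N) +_) (antidiag≡sum N _)

C-factorial : ∀ i j → ((i + j) C i) * (i ! * j !) ≡ (i + j) !
C-factorial i j = begin
  ((i + j) C i) * (i ! * j !)
    ≡⟨ cong (λ k → ((i + j) C i) * (i ! * k !)) (m+n∸m≡n i j) ⟨
  ((i + j) C i) * (i ! * (i + j ∸ i) !)
    ≡⟨ cong (_* (i ! * (i + j ∸ i) !)) (nCk≡n!/k![n-k]! (m≤m+n i j)) ⟩
  (i + j) ! / (i ! * (i + j ∸ i) !) * (i ! * (i + j ∸ i) !)
    ≡⟨ m/n*n≡m (k![n∸k]!∣n! (m≤m+n i j)) ⟩
  (i + j) ! ∎
  where
  open ≡-Reasoning
  instance
    i!*[i+j∸i]!≢0 : NonZero (i ! * (i + j ∸ i) !)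
    i!*[i+j∸i]!≢0 = i !* (i + j ∸ i) !≢0

C-absorption : ∀ i j → suc j * ((i + suc j) C i) ≡ suc (i + j) * ((i + j) C i)
C-absorption i j = *-cancelʳ-≡ _ _ (i ! * j !) {{i !* j !≢0}} $ begin
  suc j * ((i + suc j) C i) * (i ! * j !)   ≡⟨ reorder (suc j) ((i + suc j) C i) (i !) (j !) ⟩
  ((i + suc j) C i) * (i ! * (suc j) !)     ≡⟨ C-factorial i (suc j) ⟩
  (i + suc j) !                             ≡⟨ cong _! (+-suc i j) ⟩
  suc (i + j) * (i + j) !                   ≡⟨ cong (suc (i + j) *_) (C-factorial i j) ⟨
  suc (i + j) * (((i + j) C i) * (i ! * j !)) ≡⟨ *-assoc (suc (i + j)) ((i + j) C i) (i ! * j !) ⟨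
  suc (i + j) * ((i + j) C i) * (i ! * j !) ∎
  where
  open ≡-Reasoning
  reorder : ∀ s c x y → s * c * (x * y) ≡ c * (x * (s * y))
  reorder = solve-∀

binomial : ∀ x y N → (x + y) ^ N ≡ antidiag N (λ i j → ((i + j) C i) * (x ^ i * y ^ j))
binomial x y N = begin
  (x + y) ^ N                                ≡⟨ ^≡semiring-^ (x + y) N ⟩
  (x + y) SemiringExp.^ N                    ≡⟨ Binomial.theorem N x y ⟩
  Binomial.binomialExpansion x y N           ≡⟨ sum-cong-≗ term ⟨
  sum {suc N} (λ k → term′ (toℕ k) (N ∸ toℕ k)) ≡⟨ antidiag≡sum N term′ ⟨
  antidiag N term′                           ∎
  where
  open ≡-Reasoning
  term′ : ℕ → ℕ → ℕ
  term′ i j = ((i + j) C i) * (x ^ i * y ^ j)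
  term : ∀ (k : Fin (suc N)) → term′ (toℕ k) (N ∸ toℕ k) ≡ Binomial.binomialTerm x y N k
  term k = begin
    ((toℕ k + (N ∸ toℕ k)) C toℕ k) * (x ^ toℕ k * y ^ (N ∸ toℕ k))
      ≡⟨ cong (λ n → (n C toℕ k) * (x ^ toℕ k * y ^ (N ∸ toℕ k))) (m+[n∸m]≡n (toℕ≤pred[n] k)) ⟩
    (N C toℕ k) * (x ^ toℕ k * y ^ (N ∸ toℕ k))
      ≡⟨ cong₂ (λ p q → (N C toℕ k) * (p * q)) (^≡semiring-^ x (toℕ k)) (^≡semiring-^ y (N ∸ toℕ k)) ⟩
    (N C toℕ k) * (x SemiringExp.^ toℕ k * y SemiringExp.^ (N ∸ toℕ k))
      ≡⟨ *≡× (N C toℕ k) _ ⟩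
    Binomial.binomialTerm x y N k ∎

-- Partial sums of the exponential series

-- With S_K(x) = expScaled x K / K!, this is S_N(x + y) = ∑_{i + j = N} (x^i / i!) S_j(y).
expScaled-+ : ∀ x y N →
  expScaled (x + y) N ≡ antidiag N (λ i j → ((i + j) C i) * (x ^ i * expScaled y j))
expScaled-+ x y zero    = refl
expScaled-+ x y (suc N) = sym $ begin
  antidiag (suc N) T
    ≡⟨ antidiag-last N T ⟩
  antidiag N (λ i j → T i (suc j)) + T (suc N) 0
    ≡⟨ cong (_+ T (suc N) 0) (antidiag-cong N λ i j _ → split i j) ⟩
  antidiag N (λ i j → D i j + P i (suc j)) + P (suc N) 0
    ≡⟨ cong (_+ P (suc N) 0) (antidiag-distrib-+ N D (λ i j → P i (suc j))) ⟩
  antidiag N D + antidiag N (λ i j → P i (suc j)) + P (suc N) 0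
    ≡⟨ +-assoc (antidiag N D) _ _ ⟩
  antidiag N D + (antidiag N (λ i j → P i (suc j)) + P (suc N) 0)
    ≡⟨ cong₂ _+_ (antidiag-cong N absorb) (antidiag-last N P) ⟨
  antidiag N (λ i j → suc N * T i j) + antidiag (suc N) P
    ≡⟨ cong₂ _+_ (*-distribˡ-antidiag N (suc N) T) (binomial x y (suc N)) ⟨
  suc N * antidiag N T + (x + y) ^ suc N
    ≡⟨ cong (λ e → suc N * e + (x + y) ^ suc N) (expScaled-+ x y N) ⟨
  suc N * expScaled (x + y) N + (x + y) ^ suc N ∎
  where
  open ≡-Reasoning
  T P D : ℕ → ℕ → ℕ
  T i j = ((i + j) C i) * (x ^ i * expScaled y j)
  P i j = ((i + j) C i) * (x ^ i * y ^ j)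
  D i j = ((i + suc j) C i) * (x ^ i * (suc j * expScaled y j))
  split : ∀ i j → T i (suc j) ≡ D i j + P i (suc j)
  split i j = trans (cong (((i + suc j) C i) *_) (*-distribˡ-+ (x ^ i) _ _))
                    (*-distribˡ-+ ((i + suc j) C i) _ _)
  absorb : ∀ i j → i + j ≡ N → suc N * T i j ≡ D i j
  absorb i j refl = begin
    suc (i + j) * (((i + j) C i) * (x ^ i * expScaled y j))
      ≡⟨ *-assoc (suc (i + j)) ((i + j) C i) _ ⟨
    suc (i + j) * ((i + j) C i) * (x ^ i * expScaled y j)
      ≡⟨ cong (_* (x ^ i * expScaled y j)) (C-absorption i j) ⟨
    suc j * ((i + suc j) C i) * (x ^ i * expScaled y j)
      ≡⟨ reorder (suc j) ((i + suc j) C i) (x ^ i) (expScaled y j) ⟩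
    D i j ∎
    where
    reorder : ∀ s c p e → s * c * (p * e) ≡ c * (p * (s * e))
    reorder = solve-∀

expScaled-0 : ∀ j → expScaled 0 j ≡ j !
expScaled-0 zero    = refl
expScaled-0 (suc j) = trans (+-identityʳ _) (cong (suc j *_) (expScaled-0 j))

expScaled≡antidiag : ∀ x A → expScaled x A ≡ antidiag A (λ i j → ((i + j) C i) * (x ^ i * j !))
expScaled≡antidiag x A = begin
  expScaled x A
    ≡⟨ cong (λ z → expScaled z A) (+-identityʳ x) ⟨
  expScaled (x + 0) A
    ≡⟨ expScaled-+ x 0 A ⟩
  antidiag A (λ i j → ((i + j) C i) * (x ^ i * expScaled 0 j))
    ≡⟨ antidiag-cong A (λ i j _ → cong (λ z → ((i + j) C i) * (x ^ i * z)) (expScaled-0 j)) ⟩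
  antidiag A (λ i j → ((i + j) C i) * (x ^ i * j !)) ∎
  where open ≡-Reasoning

expScaled-mono : ∀ y {B C} → B ≤′ C → C ! * expScaled y B ≤ B ! * expScaled y C
expScaled-mono y              ≤′-refl           = ≤-refl
expScaled-mono y {B} {suc C} (≤′-step B≤′C) = begin
  suc C * C ! * expScaled y B         ≡⟨ *-assoc (suc C) (C !) _ ⟩
  suc C * (C ! * expScaled y B)       ≤⟨ *-monoʳ-≤ (suc C) (expScaled-mono y B≤′C) ⟩
  suc C * (B ! * expScaled y C)       ≡⟨ x∙yz≈y∙xz (suc C) (B !) _ ⟩
  B ! * (suc C * expScaled y C)       ≤⟨ *-monoʳ-≤ (B !) (m≤m+n _ _) ⟩
  B ! * expScaled y (suc C)           ∎
  where open ≤-Reasoning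

-- S_A(x) S_B(y) ≤ S_{A+B}(x + y): the left side is ∑_{i + j = A} (x^i / i!) S_B(y), and expScaled-+
-- writes the right side as ∑_{i + j = A + B} (x^i / i!) S_j(y), where S_B(y) ≤ S_{B+j}(y).
expScaled-*-≤ : ∀ x y A B →
  (B + A) ! * expScaled x A * expScaled y B ≤ A ! * B ! * expScaled (x + y) (B + A)
expScaled-*-≤ x y A B = begin
  (B + A) ! * expScaled x A * expScaled y B
    ≡⟨ xy∙z≈xz∙y ((B + A) !) (expScaled x A) (expScaled y B) ⟩
  (B + A) ! * expScaled y B * expScaled x A
    ≡⟨ cong ((B + A) ! * expScaled y B *_) (expScaled≡antidiag x A) ⟩
  (B + A) ! * expScaled y B * antidiag A (λ i j → ((i + j) C i) * (x ^ i * j !))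
    ≡⟨ *-distribˡ-antidiag A ((B + A) ! * expScaled y B) _ ⟩
  antidiag A (λ i j → (B + A) ! * expScaled y B * (((i + j) C i) * (x ^ i * j !)))
    ≤⟨ antidiag-mono-≤ A term-≤ ⟩
  antidiag A (λ i j → A ! * B ! * T i (B + j))
    ≡⟨ *-distribˡ-antidiag A (A ! * B !) (λ i j → T i (B + j)) ⟨
  A ! * B ! * antidiag A (λ i j → T i (B + j))
    ≤⟨ *-monoʳ-≤ (A ! * B !) (antidiag-shift-≤ B A T) ⟩
  A ! * B ! * antidiag (B + A) T
    ≡⟨ cong (A ! * B ! *_) (expScaled-+ x y (B + A)) ⟨
  A ! * B ! * expScaled (x + y) (B + A) ∎
  where
  open ≤-Reasoning
  T : ℕ → ℕ → ℕ
  T i j = ((i + j) C i) * (x ^ i * expScaled y j)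
  term-≤ : ∀ i j → i + j ≡ A →
    (B + A) ! * expScaled y B * (((i + j) C i) * (x ^ i * j !)) ≤ A ! * B ! * T i (B + j)
  term-≤ i j refl = *-cancelʳ-≤ _ _ (i ! * (B + j) !) {{i !* (B + j) !≢0}} $ begin
    (B + (i + j)) ! * expScaled y B * (((i + j) C i) * (x ^ i * j !)) * (i ! * (B + j) !)
      ≡⟨ reorderˡ ((B + (i + j)) !) (expScaled y B) ((i + j) C i) (x ^ i) (j !) (i !) ((B + j) !) ⟩
    (B + (i + j)) ! * x ^ i * (((i + j) C i) * (i ! * j !)) * ((B + j) ! * expScaled y B)
      ≡⟨ cong (λ z → (B + (i + j)) ! * x ^ i * z * ((B + j) ! * expScaled y B)) (C-factorial i j) ⟩
    (B + (i + j)) ! * x ^ i * (i + j) ! * ((B + j) ! * expScaled y B)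
      ≤⟨ *-monoʳ-≤ ((B + (i + j)) ! * x ^ i * (i + j) !) (expScaled-mono y (≤⇒≤′ (m≤m+n B j))) ⟩
    (B + (i + j)) ! * x ^ i * (i + j) ! * (B ! * expScaled y (B + j))
      ≡⟨ cong (λ k → k ! * x ^ i * (i + j) ! * (B ! * expScaled y (B + j))) (+.x∙yz≈y∙xz B i j) ⟩
    (i + (B + j)) ! * x ^ i * (i + j) ! * (B ! * expScaled y (B + j))
      ≡⟨ cong (λ z → z * x ^ i * (i + j) ! * (B ! * expScaled y (B + j))) (C-factorial i (B + j)) ⟨
    ((i + (B + j)) C i) * (i ! * (B + j) !) * x ^ i * (i + j) ! * (B ! * expScaled y (B + j))
      ≡⟨ reorderʳ ((i + (B + j)) C i) (i !) ((B + j) !) (x ^ i) ((i + j) !) (B !) (expScaled y (B + j)) ⟩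
    (i + j) ! * B ! * T i (B + j) * (i ! * (B + j) !) ∎
    where
    reorderˡ : ∀ F e c p f g h → F * e * (c * (p * f)) * (g * h) ≡ F * p * (c * (g * f)) * (h * e)
    reorderˡ = solve-∀
    reorderʳ : ∀ c g h p a b e → c * (g * h) * p * a * (b * e) ≡ a * b * (c * (p * e)) * (g * h)
    reorderʳ = solve-∀

expScaled-^-≤ : ∀ m K′ K → expScaled m K′ ^ K * (K * K′) ! ≤ expScaled (m * K) (K * K′) * (K′ !) ^ K
expScaled-^-≤ m K′ zero    = ≤-refl
expScaled-^-≤ m K′ (suc K) = *-cancelʳ-≤ _ _ (L !) {{L !≢0}} $ begin
  X * X ^ K * (K′ + L) ! * L !                ≡⟨ reorderˡ X (X ^ K) ((K′ + L) !) (L !) ⟩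
  (K′ + L) ! * X * (X ^ K * L !)              ≤⟨ *-monoʳ-≤ ((K′ + L) ! * X) (expScaled-^-≤ m K′ K) ⟩
  (K′ + L) ! * X * (Y * F ^ K)                ≡⟨ reorderᵐ ((K′ + L) !) X Y (F ^ K) ⟩
  (K′ + L) ! * Y * X * F ^ K                  ≤⟨ *-monoˡ-≤ (F ^ K) (expScaled-*-≤ (m * K) m L K′) ⟩
  L ! * F * expScaled (m * K + m) (K′ + L) * F ^ K
    ≡⟨ cong (λ z → L ! * F * expScaled z (K′ + L) * F ^ K) (trans (+-comm (m * K) m) (sym (*-suc m K))) ⟩
  L ! * F * expScaled (m * suc K) (K′ + L) * F ^ K
    ≡⟨ reorderʳ (L !) F (expScaled (m * suc K) (K′ + L)) (F ^ K) ⟩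
  expScaled (m * suc K) (K′ + L) * (F * F ^ K) * L ! ∎
  where
  open ≤-Reasoning
  L X Y F : ℕ
  L = K * K′
  X = expScaled m K′
  Y = expScaled (m * K) L
  F = K′ !
  reorderˡ : ∀ x xᴷ g j → x * xᴷ * g * j ≡ g * x * (xᴷ * j)
  reorderˡ = solve-∀
  reorderᵐ : ∀ g x y fᴷ → g * x * (y * fᴷ) ≡ g * y * x * fᴷ
  reorderᵐ = solve-∀
  reorderʳ : ∀ j f e fᴷ → j * f * e * fᴷ ≡ e * (f * fᴷ) * j
  reorderʳ = solve-∀

expGt-^ : ∀ {m x y n} K′ K .{{_ : NonZero x}} → x * K′ ! < y * expScaled m K′ →
  x * (x * K′ !) ≤ K → y ^ K * n ≤ x ^ K * x → ExpGt (m * K) n 1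
expGt-^ {m} {x} {y} {n} K′ K xF<yX K-large yᴷn≤xᴷx = K * K′ , *-cancelʳ-< (F ^ K) _ _ (begin-strict
  n * (K * K′) ! * F ^ K                  ≡⟨ xy∙z≈xz∙y n _ (F ^ K) ⟩
  n * F ^ K * (K * K′) !                  <⟨ *-monoˡ-< ((K * K′) !) {{(K * K′) !≢0}} nFᴷ<Xᴷ ⟩
  X ^ K * (K * K′) !                      ≤⟨ expScaled-^-≤ m K′ K ⟩
  expScaled (m * K) (K * K′) * F ^ K      ≡⟨ cong (_* F ^ K) (*-identityˡ (expScaled (m * K) (K * K′))) ⟨
  1 * expScaled (m * K) (K * K′) * F ^ K  ∎)
  where
  open ≤-Reasoning
  F X : ℕ
  F = K′ !
  X = expScaled m K′
  instance
    F≢0 : NonZero F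
    F≢0 = K′ !≢0
  nFᴷ<Xᴷ : n * F ^ K < X ^ K
  nFᴷ<Xᴷ = *-cancelˡ-< (y ^ K) _ _ $ begin-strict
    y ^ K * (n * F ^ K)   ≡⟨ *-assoc (y ^ K) n (F ^ K) ⟨
    y ^ K * n * F ^ K     ≤⟨ *-monoˡ-≤ (F ^ K) yᴷn≤xᴷx ⟩
    x ^ K * x * F ^ K     ≡⟨ xy∙z≈y∙xz (x ^ K) x (F ^ K) ⟩
    x * (x ^ K * F ^ K)   ≡⟨ cong (x *_) (^-distribʳ-* x F K) ⟨
    x * (x * F) ^ K       <⟨ c*m^k<n^k x K {{m*n≢0 x F}} xF<yX K-large ⟩
    (y * X) ^ K           ≡⟨ ^-distribʳ-* y X K ⟩
    y ^ K * X ^ K         ∎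

-- Nonzero digits of multiples of a ^ n

c≡nzDigitsFuel : ∀ b .{{_ : NonZero b}} N → c b N ≡ nzDigitsFuel b N N
c≡nzDigitsFuel (suc b) N = refl

∣-lower-digits : ∀ {a b j n s R M} → a ∣ b → j ≤ n → j ≤ s → a ^ n ∣ R + b ^ s * M → a ^ j ∣ R
∣-lower-digits {a} {b} {j} {R = R} {M} a∣b j≤n j≤s aⁿ∣R+bˢM = ∣m+n∣m⇒∣n
  (subst (a ^ j ∣_) (+-comm R _) (∣-trans (^-monoʳ-∣ a j≤n) aⁿ∣R+bˢM))
  (∣m⇒∣m*n M (∣-trans (^-monoˡ-∣ j a∣b) (^-monoʳ-∣ b j≤s)))

exponent-bound : ∀ {a b u v j t R} .{{_ : NonZero a}} .{{_ : NonZero v}} →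
  b ^ v ≤ a ^ u → a ^ j ∣ R → 0 < R → R < b ^ t → v * j < u * t
exponent-bound {a} {b} {u} {v} {j} {t} {R} bᵛ≤aᵘ aʲ∣R R>0 R<bᵗ = ^-cancelˡ-< a $ begin-strict
  a ^ (v * j)   ≡⟨ ^-*-assoc a v j ⟨
  (a ^ v) ^ j   ≡⟨ ^-^-comm a v j ⟩
  (a ^ j) ^ v   ≤⟨ ^-monoˡ-≤ v (∣⇒≤ {{>-nonZero R>0}} aʲ∣R) ⟩
  R ^ v         <⟨ ^-monoˡ-< v R<bᵗ ⟩
  (b ^ t) ^ v   ≡⟨ ^-^-comm b t v ⟩
  (b ^ v) ^ t   ≤⟨ ^-monoˡ-≤ t bᵛ≤aᵘ ⟩
  (a ^ u) ^ t   ≡⟨ ^-*-assoc a u t ⟩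
  a ^ (u * t)   ∎
  where open ≤-Reasoning

geometric-bound-base : ∀ {u v n t} → v ≤ u → v * n ≤ u * t → ∀ k → v ^ suc k * n ≤ u ^ suc k * (t + v)
geometric-bound-base {u} {v} {n} {t} v≤u vn≤ut k = begin
  v * v ^ k * n      ≡⟨ xy∙z≈y∙xz v (v ^ k) n ⟩
  v ^ k * (v * n)    ≤⟨ *-mono-≤ (^-monoˡ-≤ k v≤u) vn≤ut ⟩
  u ^ k * (u * t)    ≡⟨ x∙yz≈yx∙z (u ^ k) u t ⟩
  u * u ^ k * t      ≤⟨ *-monoʳ-≤ (u * u ^ k) (m≤m+n t v) ⟩
  u * u ^ k * (t + v) ∎
  where open ≤-Reasoning

-- The summand v in t + v absorbs the + 1 from the new digit's position, because v < u.
geometric-bound-step : ∀ {u v n s t} → v < u → v * s ≤ u * t → ∀ k →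
  v ^ suc k * n ≤ u ^ suc k * (suc s + v) → v ^ suc (suc k) * n ≤ u ^ suc (suc k) * (t + v)
geometric-bound-step {u} {v} {n} {s} {t} v<u vs≤ut k bound = begin
  v * v ^ suc k * n                      ≡⟨ *-assoc v (v ^ suc k) n ⟩
  v * (v ^ suc k * n)                    ≤⟨ *-monoʳ-≤ v bound ⟩
  v * (u ^ suc k * (suc s + v))          ≡⟨ expand v (u ^ suc k) s ⟩
  u ^ suc k * (v * s + suc v * v)        ≤⟨ *-monoʳ-≤ (u ^ suc k) (+-mono-≤ vs≤ut (*-monoˡ-≤ v v<u)) ⟩
  u ^ suc k * (u * t + u * v)            ≡⟨ cong (u ^ suc k *_) (*-distribˡ-+ u t v) ⟨
  u ^ suc k * (u * (t + v))              ≡⟨ x∙yz≈yx∙z (u ^ suc k) u (t + v) ⟩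
  u * u ^ suc k * (t + v)                ∎
  where
  open ≤-Reasoning
  expand : ∀ v U s → v * (U * (suc s + v)) ≡ U * (v * s + suc v * v)
  expand = solve-∀

module _ {a b u v n : ℕ} .{{_ : NonZero a}} .{{_ : NonZero b}} .{{_ : NonZero v}}
         (1<b : 1 < b) (a∣b : a ∣ b) (bᵛ≤aᵘ : b ^ v ≤ a ^ u) (v<u : v < u) where

  split-digit : ∀ R s M → R + b ^ s * M ≡ R + b ^ s * (M % b) + b ^ suc s * (M / b)
  split-digit R s M = begin
    R + b ^ s * M                             ≡⟨ cong (λ M → R + b ^ s * M) (m≡m%n+[m/n]*n M b) ⟩
    R + b ^ s * (M % b + M / b * b)           ≡⟨ expand R (b ^ s) (M % b) (M / b) b ⟩
    R + b ^ s * (M % b) + b * b ^ s * (M / b) ∎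
    where
    open ≡-Reasoning
    expand : ∀ r p d q b → r + p * (d + q * b) ≡ r + p * d + b * p * q
    expand = solve-∀

  append-digit-< : ∀ {R s D} → R < b ^ s → D < b → R + b ^ s * D < b ^ suc s
  append-digit-< {R} {s} {D} R<bˢ D<b = begin-strict
    R + b ^ s * D       <⟨ +-monoˡ-< (b ^ s * D) R<bˢ ⟩
    b ^ s + b ^ s * D   ≡⟨ *-suc (b ^ s) D ⟨
    b ^ s * suc D       ≤⟨ *-monoʳ-≤ (b ^ s) D<b ⟩
    b ^ s * b           ≡⟨ *-comm (b ^ s) b ⟩
    b ^ suc s           ∎
    where open ≤-Reasoning

  quotient≤fuel : ∀ {m f} → m ≤ f → suc m / b ≤ f
  quotient≤fuel m≤f = ≤-trans (≤-pred (m/n<m _ b 1<b)) m≤f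

  lower-part-bound : ∀ {j t R} → a ^ j ∣ R → 0 < R → R < b ^ t → v * j ≤ u * t
  lower-part-bound aʲ∣R R>0 R<bᵗ = <⇒≤ (exponent-bound {a} {b} {u} {v} bᵛ≤aᵘ aʲ∣R R>0 R<bᵗ)

  lower-digits-bound : ∀ {j s t R M} → j ≤ n → j ≤ s → a ^ n ∣ R + b ^ s * M → 0 < R → R < b ^ t →
    v * j ≤ u * t
  lower-digits-bound j≤n j≤s aⁿ∣R+bˢM = lower-part-bound (∣-lower-digits {a} {b} a∣b j≤n j≤s aⁿ∣R+bˢM)

  R+bˢ*0≡R : ∀ R s → R + b ^ s * 0 ≡ R
  R+bˢ*0≡R R s = trans (cong (R +_) (*-zeroʳ (b ^ s))) (+-identityʳ R)

  drop-zero-digit : ∀ R s {M} → M % b ≡ 0 → R + b ^ s * M ≡ R + b ^ suc s * (M / b)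
  drop-zero-digit R s {M} M%b≡0 = begin
    R + b ^ s * M
      ≡⟨ split-digit R s M ⟩
    R + b ^ s * (M % b) + b ^ suc s * (M / b)
      ≡⟨ cong (λ d → R + b ^ s * d + b ^ suc s * (M / b)) M%b≡0 ⟩
    R + b ^ s * 0 + b ^ suc s * (M / b)
      ≡⟨ cong (_+ b ^ suc s * (M / b)) (R+bˢ*0≡R R s) ⟩
    R + b ^ suc s * (M / b) ∎
    where open ≡-Reasoning

  no-upper-digits-bound : ∀ {s t R} → 0 < R → R < b ^ t → a ^ n ∣ R + b ^ s * 0 →
    v ^ 1 * n ≤ u ^ 1 * (t + v)
  no-upper-digits-bound {s} {t} {R} R>0 R<bᵗ aⁿ∣R+bˢ0 = geometric-bound-base (<⇒≤ v<u)
    (lower-part-bound (subst (a ^ n ∣_) (R+bˢ*0≡R R s) aⁿ∣R+bˢ0) R>0 R<bᵗ) 0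

  -- N = R + b ^ s * M: R < b ^ t is the part of N below position s, and M has nzDigitsFuel b f M
  -- nonzero digits. A nonzero digit at position s < n forces v s ≤ u t, so n ≤ (u/v)^(k+1) (t + v).
  nzDigitsFuel-bound : ∀ f M → M ≤ f → ∀ {s t R} → t ≤ s → 0 < R → R < b ^ t → a ^ n ∣ R + b ^ s * M →
    v ^ suc (nzDigitsFuel b f M) * n ≤ u ^ suc (nzDigitsFuel b f M) * (t + v)
  nzDigitsFuel-bound zero    zero _ {s} _ = no-upper-digits-bound {s}
  nzDigitsFuel-bound (suc f) zero _ {s} _ = no-upper-digits-bound {s}
  nzDigitsFuel-bound (suc f) (suc m) (s≤s m≤f) {s} {t} {R} t≤s R>0 R<bᵗ aⁿ∣R+bˢM
    with suc m % b in eq | n ≤? s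
  ... | zero  | _       =
    nzDigitsFuel-bound f (suc m / b) (quotient≤fuel m≤f) (m≤n⇒m≤1+n t≤s) R>0 R<bᵗ
      (subst (a ^ n ∣_) (drop-zero-digit R s eq) aⁿ∣R+bˢM)
  ... | suc _ | yes n≤s =
    geometric-bound-base (<⇒≤ v<u) (lower-digits-bound ≤-refl n≤s aⁿ∣R+bˢM R>0 R<bᵗ)
      (suc (nzDigitsFuel b f (suc m / b)))
  ... | suc _ | no  n≰s =
    geometric-bound-step {s = s} v<u (lower-digits-bound (<⇒≤ (≰⇒> n≰s)) ≤-refl aⁿ∣R+bˢM R>0 R<bᵗ)
      (nzDigitsFuel b f (suc m / b))
      (nzDigitsFuel-bound f (suc m / b) (quotient≤fuel m≤f) ≤-refl
        (≤-trans R>0 (m≤m+n R _))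
        (append-digit-< {s = s} (<-≤-trans R<bᵗ (^-monoʳ-≤ b t≤s)) (m%n<n (suc m) b))
        (subst (a ^ n ∣_) (split-digit R s (suc m)) aⁿ∣R+bˢM))

  digit-count-bound : ∀ {N} → a ^ n ∣ N → ¬ (b ∣ N) → v ^ c b N * n ≤ u ^ c b N * u
  digit-count-bound {zero}      _    b∤0 = contradiction (b ∣0) b∤0
  digit-count-bound {N@(suc m)} aⁿ∣N b∤N rewrite c≡nzDigitsFuel b N with N % b in eq
  ... | zero  = contradiction (m%n≡0⇒n∣m N b eq) b∤N
  ... | suc _ = ≤-trans
    (nzDigitsFuel-bound m (N / b) (quotient≤fuel ≤-refl) ≤-refl
      (subst (0 <_) (sym eq) z<s)
      (subst (N % b <_) (sym (*-identityʳ b)) (m%n<n N b))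
      (subst (a ^ n ∣_) N≡lowest+rest aⁿ∣N))
    (*-monoʳ-≤ (u ^ suc (nzDigitsFuel b m (N / b))) v<u)
    where
    N≡lowest+rest : N ≡ N % b + b ^ 1 * (N / b)
    N≡lowest+rest = trans (sym (+-identityʳ N))
      (trans (split-digit 0 0 N) (cong (_+ b ^ 1 * (N / b)) (+-identityʳ (N % b))))

LogLowerBound : (a b m p : ℕ) → Set
LogLowerBound a b m p = ∃ λ n₀ → (n : ℕ) → n ≥ n₀ → (N : ℕ) → 1 ≤ N → a ^ n ∣ N → ¬ (b ∣ N) →
  ExpGt (m * c b N) (n ^ p) 1

log-lower-bound : ∀ {a b} .{{_ : NonZero a}} .{{_ : NonZero b}} → 1 < b → a < b → a ∣ b →
  ∀ m p u v K′ → 1 ≤ v → b ^ v < a ^ u → u ^ p * K′ ! < v ^ p * expScaled m K′ →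
  LogLowerBound a b m p
log-lower-bound {a} {b} 1<b a<b a∣b m p u v K′ 1≤v bᵛ<aᵘ uᵖF<vᵖX = suc (u ^ K₀) , bound
  where
  instance
    v≢0 : NonZero v
    v≢0 = >-nonZero 1≤v
  v<u : v < u
  v<u = ^-cancelˡ-< a (<-trans (^-monoˡ-< v a<b) bᵛ<aᵘ)
  instance
    u≢0 : NonZero u
    u≢0 = >-nonZero (≤-<-trans z≤n v<u)
    uᵖ≢0 : NonZero (u ^ p)
    uᵖ≢0 = m^n≢0 u p
  K₀ : ℕ
  K₀ = u ^ p * (u ^ p * K′ !)
  bound : (n : ℕ) → n ≥ suc (u ^ K₀) → (N : ℕ) → 1 ≤ N → a ^ n ∣ N → ¬ (b ∣ N) →
    ExpGt (m * c b N) (n ^ p) 1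
  bound n n>uᴷ⁰ N _ aⁿ∣N b∤N = expGt-^ K′ K uᵖF<vᵖX K₀≤K digits^p
    where
    K : ℕ
    K = c b N
    digits : v ^ K * n ≤ u ^ K * u
    digits = digit-count-bound 1<b a∣b (<⇒≤ bᵛ<aᵘ) v<u aⁿ∣N b∤N
    digits^p : (v ^ p) ^ K * n ^ p ≤ (u ^ p) ^ K * u ^ p
    digits^p = subst₂ _≤_
      (trans (^-distribʳ-* (v ^ K) n p) (cong (_* n ^ p) (^-^-comm v K p)))
      (trans (^-distribʳ-* (u ^ K) u p) (cong (_* u ^ p) (^-^-comm u K p)))
      (^-monoˡ-≤ p digits)
    K₀≤K : K₀ ≤ K
    K₀≤K = ≤-pred $ ^-cancelˡ-< u $ begin-strict
      u ^ K₀      <⟨ n>uᴷ⁰ ⟩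
      n           ≤⟨ m≤n*m n (v ^ K) {{m^n≢0 v K}} ⟩
      v ^ K * n   ≤⟨ digits ⟩
      u ^ K * u   ≡⟨ *-comm (u ^ K) u ⟩
      u ^ suc K   ∎
      where open ≤-Reasoning

theorem4p2 : (a b : ℕ) → 2 ≤ a → a < b → a ∣ b →
    (Σ ℕ λ p → Σ ℕ λ q → 1 ≤ p ×
      ∃ λ n₀ → (n : ℕ) → n ≥ n₀ → (N : ℕ) → 1 ≤ N → a ^ n ∣ N → ¬ (b ∣ N) →
        ExpGt (suc q * c b N) (n ^ p) 1)
    × ((p q : ℕ) → 1 ≤ p →
      (∃ λ u → ∃ λ v → 1 ≤ v × b ^ v < a ^ u × ExpGt (suc q) (u ^ p) (v ^ p)) →
      ∃ λ n₀ → (n : ℕ) → n ≥ n₀ → (N : ℕ) → 1 ≤ N → a ^ n ∣ N → ¬ (b ∣ N) →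
        ExpGt (suc q * c b N) (n ^ p) 1)
theorem4p2 zero      _         ()  _   _
theorem4p2 (suc _)   zero      _   ()  _
theorem4p2 a@(suc _) b@(suc _) 2≤a a<b a∣b =
  (1 , b , ≤-refl , admissible 1 b ≤-refl (b , 1 , ≤-refl , b<aᵇ , e^[b+1]>b)) , admissible
  where
  admissible : (p q : ℕ) → 1 ≤ p →
    (∃ λ u → ∃ λ v → 1 ≤ v × b ^ v < a ^ u × ExpGt (suc q) (u ^ p) (v ^ p)) →
    LogLowerBound a b (suc q) p
  admissible p q _ (u , v , 1≤v , bᵛ<aᵘ , K′ , uᵖF<vᵖX) =
    log-lower-bound (<-trans 2≤a a<b) a<b a∣b (suc q) p u v K′ 1≤v bᵛ<aᵘ uᵖF<vᵖX
  b<aᵇ : b ^ 1 < a ^ b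
  b<aᵇ = subst (_< a ^ b) (cong (b *_) (^-zeroˡ b)) (c*m^k<n^k b b 2≤a (≤-reflexive (*-identityʳ b)))
  e^[b+1]>b : ExpGt (suc b) (b ^ 1) (1 ^ 1)
  e^[b+1]>b =
    1 , subst₂ _<_ (sym (*-identityʳ (b * 1))) (sym (+-identityʳ _)) (m<n⇒m<1+n (n<1+n (b * 1)))
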